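{- Let $(X,\preceq)$ be a simple prefix order. Then the space $X^\infty$ equipped with its Scott topology is sober.
   Context: A prefix order is a partial order in which every principal ideal is totally ordered; it is simple if every principal ideal $\{y\mid y\preceq x\}$ is finite. Equip $X$ with the Alexandroff topology (open = upward closed, closed = downward closed). A closed set $C$ is irreducible if nonempty and whenever $C=C_1\cup C_2$ with $C_1,C_2$ closed then $C=C_1$ or $C=C_2$; $C$ is non-sober if it is closed, irreducible, and not the closure ${\downarrow}x$ of any point $x\in X$. Define $X^\infty=X\cup\{\infty_C\mid C\subseteq X\text{ non-sober}\}$ ordered by $\preceq'={\preceq}\cup\{(\infty_C,\infty_C)\}\cup\{(x,\infty_C)\mid x\in C\}$. A subset $U\subseteq X^\infty$ is Scott open iff it is upward closed and for every directed $D\subseteq X^\infty$ whose supremum exists and lies in $U$, $D\cap U\ne\emptyset$. A topological space is sober if every irreducible closed set is the closure of a unique point. -}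

module Defs where

open import Level using (Level; 0ℓ) renaming (suc to lsuc)
open import Data.Product using (Σ; ∃; _×_; _,_)
open import Data.Sum using (_⊎_; inj₁; inj₂)
open import Data.Empty using (⊥)
open import Data.List using (List)
open import Data.List.Membership.Propositional using (_∈_)
open import Relation.Nullary using (¬_)
open import Relation.Binary.Core using (Rel)
open import Relation.Binary.Structures using (IsPartialOrder)
open import Relation.Binary.PropositionalEquality using (_≡_)
open import Relation.Unary using (Pred)

_≐_ : ∀ {a ℓ₁ ℓ₂} {A : Set a} → Pred A ℓ₁ → Pred A ℓ₂ → Set _
P ≐ Q = ∀ x → (P x → Q x) × (Q x → P x)

_∪_ : ∀ {a ℓ} {A : Set a} → Pred A ℓ → Pred A ℓ → Pred A ℓ
(P ∪ Q) x = P x ⊎ Q x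

∁ : ∀ {a ℓ} {A : Set a} → Pred A ℓ → Pred A ℓ
∁ P x = ¬ P x

IsPrefixOrder : {X : Set} → Rel X 0ℓ → Set
IsPrefixOrder {X} _≼_ =
  IsPartialOrder _≡_ _≼_ ×
  (∀ x y z → y ≼ x → z ≼ x → (y ≼ z) ⊎ (z ≼ y))

Finite : {X : Set} → Pred X 0ℓ → Set
Finite {X} P = Σ (List X) λ l → ∀ y → P y → y ∈ l

IsSimplePrefixOrder : {X : Set} → Rel X 0ℓ → Set
IsSimplePrefixOrder {X} _≼_ =
  IsPrefixOrder _≼_ × (∀ x → Finite (λ y → y ≼ x))

module Alexandroff {X : Set} (_≼_ : Rel X 0ℓ) where

  ↓ : X → Pred X 0ℓ
  ↓ x y = y ≼ x

  IsClosed : Pred X 0ℓ → Set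
  IsClosed C = ∀ x y → y ≼ x → C x → C y

  IsIrreducible : Pred X 0ℓ → Set₁
  IsIrreducible C =
    IsClosed C × (∃ λ x → C x) ×
    (∀ C₁ C₂ → IsClosed C₁ → IsClosed C₂ → C ≐ (C₁ ∪ C₂) → (C ≐ C₁) ⊎ (C ≐ C₂))

  IsNonSober : Pred X 0ℓ → Set₁
  IsNonSober C = IsClosed C × IsIrreducible C × (¬ (∃ λ x → C ≐ ↓ x))

  -- X^∞ : points of X together with a point ∞_C for each non-sober C.
  -- Since subsets are predicates, ∞_C and ∞_D are identified (via _≈∞_)
  -- whenever C and D are extensionally equal.

  X∞ : Set₁
  X∞ = X ⊎ Σ (Pred X 0ℓ) IsNonSober

  _≈∞_ : X∞ → X∞ → Set
  inj₁ x ≈∞ inj₁ y = x ≡ y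
  inj₁ x ≈∞ inj₂ D = ⊥
  inj₂ C ≈∞ inj₁ y = ⊥
  inj₂ (C , _) ≈∞ inj₂ (D , _) = C ≐ D

  _≼'_ : X∞ → X∞ → Set
  inj₁ x ≼' inj₁ y = x ≼ y
  inj₁ x ≼' inj₂ (C , _) = C x
  inj₂ C ≼' inj₁ y = ⊥
  inj₂ (C , _) ≼' inj₂ (D , _) = C ≐ D

  IsUpwardClosed : Pred X∞ 0ℓ → Set₁
  IsUpwardClosed U = ∀ p q → p ≼' q → U p → U q

  IsDirected : Pred X∞ 0ℓ → Set₁
  IsDirected D =
    (∃ λ p → D p) ×
    (∀ p q → D p → D q → ∃ λ r → D r × p ≼' r × q ≼' r)

  IsSupremum : Pred X∞ 0ℓ → X∞ → Set₁
  IsSupremum D s =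
    (∀ p → D p → p ≼' s) ×
    (∀ u → (∀ p → D p → p ≼' u) → s ≼' u)

  IsScottOpen : Pred X∞ 0ℓ → Set₁
  IsScottOpen U =
    IsUpwardClosed U ×
    (∀ D → IsDirected D → ∀ s → IsSupremum D s → U s → ∃ λ p → D p × U p)

module Sobriety {A : Set₁} (_≈_ : A → A → Set) (IsOpen : Pred A 0ℓ → Set₁) where

  IsClosedT : Pred A 0ℓ → Set₁
  IsClosedT F = IsOpen (∁ F)

  IsIrreducibleT : Pred A 0ℓ → Set₁
  IsIrreducibleT F =
    IsClosedT F × (∃ λ p → F p) ×
    (∀ F₁ F₂ → IsClosedT F₁ → IsClosedT F₂ → F ≐ (F₁ ∪ F₂) → (F ≐ F₁) ⊎ (F ≐ F₂))

  closure : A → Pred A (lsuc 0ℓ)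
  closure p q = ∀ (F : Pred A 0ℓ) → IsClosedT F → F p → F q

  IsSober : Set₁
  IsSober = ∀ F → IsIrreducibleT F →
    Σ A λ p → (F ≐ closure p) × (∀ q → F ≐ closure q → q ≈ p)

-- A space is sober as soon as every irreducible closed set F has a
-- greatest element p in the specialisation order: then F = ↓p = closure p,
-- and p is unique by antisymmetry.  For the Scott topology on X^∞ we find p
-- by looking at the set A of points of X lying in F.  Irreducibility of F
-- makes A directed (the Scott opens ↑x, ↑y both meet F, hence so does their
-- intersection).  If A has a greatest element m, then inj₁ m is greatest in
-- F, because a non-sober set C ⊆ A would be bounded by m.  Otherwise A is
-- itself non-sober, F contains ∞_A = sup A, and ∞_A is greatest in F.
--
-- The simplicity of X enters through one fact: a directed set that is
-- bounded above lies in a finite principal ideal, and hence has a greatest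
-- element.  Consequently non-sober sets are unbounded, non-sober sets are
-- pairwise incomparable under inclusion, and ↑x is Scott open.

module Submission where

open import Defs
open import Level using (0ℓ)
open import Axiom.ExcludedMiddle using (ExcludedMiddle)
open import Axiom.DoubleNegationElimination using (em⇒dne)
open import Data.Product using (∃; _×_; _,_; proj₁; proj₂)
open import Data.Sum using (_⊎_; inj₁; inj₂; [_,_]′)
open import Data.Empty using (⊥; ⊥-elim)
open import Data.List using (List; []; _∷_; map)
open import Data.List.Membership.Propositional using (_∈_)
open import Data.List.Membership.Propositional.Properties using (∈-map⁺)
open import Data.List.Relation.Unary.Any using (here; there)
open import Relation.Nullary using (¬_; yes; no)
open import Relation.Binary.Core using (Rel)
open import Relation.Binary.Definitions using (Transitive)
open import Relation.Binary.Structures using (IsPartialOrder)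
open import Relation.Binary.PropositionalEquality using (_≡_; refl)
open import Relation.Unary using (Pred; _∖_)

Directed : ∀ {a ℓ p} {A : Set a} → Rel A ℓ → Pred A p → Set _
Directed _≤_ D = ∀ x y → D x → D y → ∃ λ z → D z × x ≤ z × y ≤ z

HasGreatest : ∀ {a ℓ p} {A : Set a} → Rel A ℓ → Pred A p → Set _
HasGreatest _≤_ D = ∃ λ m → D m × (∀ x → D x → x ≤ m)

module Classical (em : ∀ {ℓ} → ExcludedMiddle ℓ) where

  dne : ∀ {ℓ} {P : Set ℓ} → ¬ ¬ P → P
  dne = em⇒dne em

  module _ {a ℓ p} {A : Set a} {_≤_ : Rel A ℓ} (≤-trans : Transitive _≤_)
           {D : Pred A p} (directed : Directed _≤_ D) (nonempty : ∃ D) where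

    above-listed : (l : List A) → ∃ λ m → D m × (∀ x → x ∈ l → D x → x ≤ m)
    above-listed [] = proj₁ nonempty , proj₂ nonempty , λ _ ()
    above-listed (a ∷ l) with above-listed l
    ... | m , Dm , m-above with em {P = D a}
    ...   | no ¬Da = m , Dm , λ { x (here refl) Dx → ⊥-elim (¬Da Dx)
                                ; x (there x∈l) Dx → m-above x x∈l Dx }
    ...   | yes Da with directed a m Da Dm
    ...     | r , Dr , a≤r , m≤r = r , Dr , λ { x (here refl) _ → a≤r
                                              ; x (there x∈l) Dx → ≤-trans (m-above x x∈l Dx) m≤r }

    listed-directed-greatest : (l : List A) → (∀ x → D x → x ∈ l) → HasGreatest _≤_ D
    listed-directed-greatest l D⊆l with above-listed l
    ... | m , Dm , m-above = m , Dm , λ x Dx → m-above x (D⊆l x Dx) Dx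

  irreducible-meets : ∀ {a c} {A : Set a} (IsClosedSet : Pred A 0ℓ → Set c) {F U V : Pred A 0ℓ} →
    (∀ F₁ F₂ → IsClosedSet F₁ → IsClosedSet F₂ → F ≐ (F₁ ∪ F₂) → (F ≐ F₁) ⊎ (F ≐ F₂)) →
    IsClosedSet (F ∖ U) → IsClosedSet (F ∖ V) →
    (∃ λ p → F p × U p) → (∃ λ q → F q × V q) → ∃ λ r → F r × U r × V r
  irreducible-meets _ {F} {U} {V} split closedᵤ closedᵥ (p , Fp , Up) (q , Fq , Vq) =
    dne λ disjoint →
      [ (λ F≐F∖U → proj₂ (proj₁ (F≐F∖U p) Fp) Up)
      , (λ F≐F∖V → proj₂ (proj₁ (F≐F∖V q) Fq) Vq)
      ]′ (split (F ∖ U) (F ∖ V) closedᵤ closedᵥ (cover disjoint))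
    where
    cover : ¬ (∃ λ r → F r × U r × V r) → F ≐ ((F ∖ U) ∪ (F ∖ V))
    cover disjoint x = into , [ proj₁ , proj₁ ]′
      where
      into : F x → ((F ∖ U) ∪ (F ∖ V)) x
      into Fx with em {P = U x}
      ... | yes Ux = inj₂ (Fx , λ Vx → disjoint (x , Fx , Ux , Vx))
      ... | no ¬Ux = inj₁ (Fx , ¬Ux)

  module SimplePrefixOrder {X : Set} (_≼_ : Rel X 0ℓ) (simple : IsSimplePrefixOrder _≼_) where
    open Alexandroff _≼_
    open Sobriety _≈∞_ IsScottOpen
    open IsPartialOrder (proj₁ (proj₁ simple))
      using (antisym) renaming (refl to ≼-refl; trans to ≼-trans)

    -- Directed sets are chains, since principal ideals are chains.
    directed-comparable : ∀ {D : Pred X 0ℓ} → Directed _≼_ D → ∀ {x y} → D x → D y → (x ≼ y) ⊎ (y ≼ x)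
    directed-comparable directed {x} {y} Dx Dy with directed x y Dx Dy
    ... | z , _ , x≼z , y≼z = proj₂ (proj₁ simple) z x y x≼z y≼z

    -- Irreducible closed sets are directed: the up-sets of x and y both meet C.
    irreducible⇒directed : ∀ {C} → IsIrreducible C → Directed _≼_ C
    irreducible⇒directed {C} (closed , _ , split) x y Cx Cy =
      irreducible-meets IsClosed split (minus-up x) (minus-up y) (x , Cx , ≼-refl) (y , Cy , ≼-refl)
      where
      minus-up : ∀ u → IsClosed (C ∖ λ w → u ≼ w)
      minus-up u w w′ w′≼w (Cw , u⋠w) = closed w w′ w′≼w Cw , λ u≼w′ → u⋠w (≼-trans u≼w′ w′≼w)

    directed⇒irreducible : ∀ {C} → IsClosed C → ∃ C → Directed _≼_ C → IsIrreducible C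
    directed⇒irreducible {C} closed nonempty directed = closed , nonempty , split
      where
      split : ∀ C₁ C₂ → IsClosed C₁ → IsClosed C₂ → C ≐ (C₁ ∪ C₂) → (C ≐ C₁) ⊎ (C ≐ C₂)
      split C₁ C₂ closed₁ closed₂ cover with em {P = ∀ x → C x → C₁ x}
      ... | yes C⊆C₁ = inj₁ λ x → C⊆C₁ x , λ C₁x → proj₂ (cover x) (inj₁ C₁x)
      ... | no C⊈C₁ = inj₂ λ x → C⊆C₂ x , λ C₂x → proj₂ (cover x) (inj₂ C₂x)
        where
        forces-C₁ : ∀ x → C x → ¬ C₂ x → ∀ y → C y → C₁ y
        forces-C₁ x Cx ¬C₂x y Cy with directed x y Cx Cy
        ... | z , Cz , x≼z , y≼z with proj₁ (cover z) Cz
        ...   | inj₁ C₁z = closed₁ z y y≼z C₁z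
        ...   | inj₂ C₂z = ⊥-elim (¬C₂x (closed₂ z x x≼z C₂z))
        C⊆C₂ : ∀ x → C x → C₂ x
        C⊆C₂ x Cx = dne λ ¬C₂x → C⊈C₁ (forces-C₁ x Cx ¬C₂x)

    -- Simplicity: a bounded nonempty directed set lies in a finite ideal,
    -- hence has a greatest element.
    bounded-directed-greatest : ∀ {D : Pred X 0ℓ} → Directed _≼_ D → ∃ D →
      ∀ y → (∀ x → D x → x ≼ y) → HasGreatest _≼_ D
    bounded-directed-greatest directed nonempty y bounded =
      listed-directed-greatest ≼-trans directed nonempty ideal
        (λ x Dx → enumerates x (bounded x Dx))
      where
      ideal : List X
      ideal = proj₁ (proj₂ simple y)
      enumerates : ∀ x → x ≼ y → x ∈ ideal
      enumerates = proj₂ (proj₂ simple y)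

    -- A non-sober set has no upper bound in X (else it would be ↓ of its maximum).
    nonSober-unbounded : ∀ {C} → IsNonSober C → ∀ y → ¬ (∀ x → C x → x ≼ y)
    nonSober-unbounded (closed , irreducible , nonPrincipal) y bounded
      with bounded-directed-greatest (irreducible⇒directed irreducible)
                                     (proj₁ (proj₂ irreducible)) y bounded
    ... | m , Cm , greatest = nonPrincipal (m , λ x → greatest x , λ x≼m → closed m x x≼m Cm)

    -- Nested non-sober sets are equal: were y ∈ C ∖ A, the chain C would
    -- place every member of the down-set A below y.
    nonSober-nested : ∀ {A C} → IsNonSober A → IsNonSober C → (∀ x → A x → C x) → A ≐ C
    nonSober-nested {A} {C} (closedᴬ , irreducibleᴬ , nonPrincipalᴬ) (_ , irreducibleᶜ , _) A⊆C y =
      A⊆C y , λ Cy → dne λ ¬Ay →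
        nonSober-unbounded (closedᴬ , irreducibleᴬ , nonPrincipalᴬ) y (below-y Cy ¬Ay)
      where
      below-y : C y → ¬ A y → ∀ a → A a → a ≼ y
      below-y Cy ¬Ay a Aa with directed-comparable (irreducible⇒directed irreducibleᶜ) (A⊆C a Aa) Cy
      ... | inj₁ a≼y = a≼y
      ... | inj₂ y≼a = ⊥-elim (¬Ay (closedᴬ a y y≼a Aa))

    ∞ : ∀ {C} → IsNonSober C → X∞
    ∞ {C} nonSober = inj₂ (C , nonSober)

    ≼′-refl : ∀ p → p ≼' p
    ≼′-refl (inj₁ x) = ≼-refl
    ≼′-refl (inj₂ _) = λ _ → (λ c → c) , (λ c → c)

    ≼′-trans : ∀ p q r → p ≼' q → q ≼' r → p ≼' r
    ≼′-trans (inj₁ _) (inj₁ _) (inj₁ _) x≼y y≼z = ≼-trans x≼y y≼z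
    ≼′-trans (inj₁ x) (inj₁ y) (inj₂ (C , closed , _)) x≼y Cy = closed y x x≼y Cy
    ≼′-trans (inj₁ x) (inj₂ _) (inj₂ _) Cx C≐D = proj₁ (C≐D x) Cx
    ≼′-trans (inj₂ _) (inj₂ _) (inj₂ _) C≐D D≐E =
      λ x → (λ Cx → proj₁ (D≐E x) (proj₁ (C≐D x) Cx)) , (λ Ex → proj₂ (C≐D x) (proj₂ (D≐E x) Ex))
    ≼′-trans (inj₁ _) (inj₂ _) (inj₁ _) _ ()
    ≼′-trans (inj₂ _) (inj₁ _) _ ()
    ≼′-trans (inj₂ _) (inj₂ _) (inj₁ _) _ ()

    ≼′-antisym : ∀ p q → p ≼' q → q ≼' p → q ≈∞ p
    ≼′-antisym (inj₁ _) (inj₁ _) x≼y y≼x = antisym y≼x x≼y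
    ≼′-antisym (inj₁ _) (inj₂ _) _ ()
    ≼′-antisym (inj₂ _) (inj₂ _) _ D≐C = D≐C

    below-point : ∀ {y} d → d ≼' inj₁ y → ∃ λ e → d ≡ inj₁ e
    below-point (inj₁ e) _ = e , refl

    points-below-nonempty : ∀ p → ∃ λ x → inj₁ x ≼' p
    points-below-nonempty (inj₁ x) = x , ≼-refl
    points-below-nonempty (inj₂ (_ , _ , irreducible , _)) = proj₁ (proj₂ irreducible)

    points-below-directed : ∀ p → Directed _≼_ (λ x → inj₁ x ≼' p)
    points-below-directed (inj₁ r) x y x≼r y≼r = r , ≼-refl , x≼r , y≼r
    points-below-directed (inj₂ (_ , _ , irreducible , _)) = irreducible⇒directed irreducible

    embed : Pred X 0ℓ → Pred X∞ 0ℓ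
    embed C (inj₁ x) = C x
    embed C (inj₂ _) = ⊥

    -- C is directed in X^∞ with supremum ∞_C: an upper bound in X is
    -- impossible, and an upper bound ∞_D has D = C by nestedness.
    embed-directed : ∀ {C} → IsNonSober C → IsDirected (embed C)
    embed-directed (_ , (_ , (x , Cx) , _) , _) .proj₁ = inj₁ x , Cx
    embed-directed (_ , irreducible , _) .proj₂ (inj₁ x) (inj₁ y) Cx Cy
      with irreducible⇒directed irreducible x y Cx Cy
    ... | z , Cz , x≼z , y≼z = inj₁ z , Cz , x≼z , y≼z

    embed-supremum : ∀ {C} (nonSober : IsNonSober C) → IsSupremum (embed C) (∞ nonSober)
    embed-supremum nonSober .proj₁ (inj₁ x) Cx = Cx
    embed-supremum nonSober .proj₂ (inj₁ y) upper =
      ⊥-elim (nonSober-unbounded nonSober y (λ x Cx → upper (inj₁ x) Cx))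
    embed-supremum nonSober .proj₂ (inj₂ (_ , nonSoberᴰ)) upper =
      nonSober-nested nonSober nonSoberᴰ (λ x Cx → upper (inj₁ x) Cx)

    -- A nonempty directed set bounded by a point of X is finite, so has a greatest element.
    bounded-directed-greatest′ : ∀ {D} → IsDirected D →
      ∀ y → (∀ d → D d → d ≼' inj₁ y) → HasGreatest _≼'_ D
    bounded-directed-greatest′ {D} (nonempty , directed) y bounded =
      listed-directed-greatest (λ {p} {q} {r} → ≼′-trans p q r) directed nonempty (map inj₁ ideal) D⊆ideal
      where
      ideal : List X
      ideal = proj₁ (proj₂ simple y)
      D⊆ideal : ∀ d → D d → d ∈ map inj₁ ideal
      D⊆ideal d Dd with below-point d (bounded d Dd) | bounded d Dd
      ... | e , refl | e≼y = ∈-map⁺ inj₁ (proj₂ (proj₂ simple y) e e≼y)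

    closed-down : ∀ {F} → IsClosedT F → ∀ p q → q ≼' p → F p → F q
    closed-down closed p q q≼p Fp = dne λ ¬Fq → proj₁ closed q p q≼p ¬Fq Fp

    closed-supremum : ∀ {F D s} → IsClosedT F → IsDirected D → IsSupremum D s →
      (∀ d → D d → F d) → F s
    closed-supremum closed directed supremum D⊆F =
      dne λ ¬Fs → let (d , Dd , ¬Fd) = proj₂ closed _ directed _ supremum ¬Fs in ¬Fd (D⊆F d Dd)

    down-closed : ∀ p → IsClosedT (λ q → q ≼' p)
    down-closed p .proj₁ q r q≼r q⋠p r≼p = q⋠p (≼′-trans q r p q≼r r≼p)
    down-closed p .proj₂ D _ s supremum s⋠p =
      dne λ D≼p → s⋠p (proj₂ supremum p λ d Dd → dne λ d⋠p → D≼p (d , Dd , d⋠p))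

    closure≐down : ∀ p → closure p ≐ (λ q → q ≼' p)
    closure≐down p q = (λ q∈cl → q∈cl _ (down-closed p) (≼′-refl p))
                     , (λ q≼p F closed Fp → closed-down closed p q q≼p Fp)

    -- For a directed D with
    -- supremum s ≽ x: if s ∈ X, then D has a greatest element, lying above s;
    -- if s = ∞_S and no member of D is above x, then x, being comparable
    -- with every member of the chain S, bounds D, which is absurd.
    up-open : ∀ x → IsScottOpen (λ p → inj₁ x ≼' p)
    up-open x .proj₁ p q p≼q x≼p = ≼′-trans (inj₁ x) p q x≼p p≼q
    up-open x .proj₂ D directed (inj₁ y) supremum x≼y
      with bounded-directed-greatest′ directed y (proj₁ supremum)
    ... | m , Dm , greatest = m , Dm , ≼′-trans (inj₁ x) (inj₁ y) m x≼y (proj₂ supremum m greatest)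
    up-open x .proj₂ D directed (inj₂ (S , _ , irreducibleˢ , _)) supremum Sx =
      dne λ none → proj₂ supremum (inj₁ x) (below-x none)
      where
      below-x : ¬ (∃ λ d → D d × inj₁ x ≼' d) → ∀ d → D d → d ≼' inj₁ x
      below-x none (inj₁ e) De
        with directed-comparable (irreducible⇒directed irreducibleˢ) Sx (proj₁ supremum (inj₁ e) De)
      ... | inj₁ x≼e = ⊥-elim (none (inj₁ e , De , x≼e))
      ... | inj₂ e≼x = e≼x
      below-x none (inj₂ C) DC = ⊥-elim (none (inj₂ C , DC , proj₂ (proj₁ supremum _ DC x) Sx))

    minus-open-closed : ∀ {F U} → IsClosedT F → IsScottOpen U → IsClosedT (F ∖ U)
    minus-open-closed {F} {U} closed open′ = upward , scott
      where
      upward : ∀ p q → p ≼' q → ¬ (F ∖ U) p → ¬ (F ∖ U) q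
      upward p q p≼q p∉ (Fq , ¬Uq) = p∉ (closed-down closed q p p≼q Fq , λ Up → ¬Uq (proj₁ open′ p q p≼q Up))
      scott : ∀ D → IsDirected D → ∀ s → IsSupremum D s → ¬ (F ∖ U) s → ∃ λ d → D d × ¬ (F ∖ U) d
      scott D directed s supremum s∉ with em {P = F s}
      ... | no ¬Fs = let (d , Dd , ¬Fd) = proj₂ closed D directed s supremum ¬Fs in d , Dd , λ d∈ → ¬Fd (proj₁ d∈)
      ... | yes Fs = let (d , Dd , Ud) = proj₂ open′ D directed s supremum (dne λ ¬Us → s∉ (Fs , ¬Us))
                     in d , Dd , λ d∈ → proj₂ d∈ Ud

    module Irreducible {F : Pred X∞ 0ℓ} (irreducible : IsIrreducibleT F) where
      closed : IsClosedT F
      closed = proj₁ irreducible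

      A : Pred X 0ℓ
      A x = F (inj₁ x)

      A-closed : IsClosed A
      A-closed x y y≼x = closed-down closed (inj₁ x) (inj₁ y) y≼x

      A-nonempty : ∃ A
      A-nonempty with proj₁ (proj₂ irreducible)
      ... | p , Fp with points-below-nonempty p
      ...   | x , x≼p = x , closed-down closed p (inj₁ x) x≼p Fp

      -- F meets ↑x ∩ ↑y, and the points below that meeting point are directed.
      A-directed : Directed _≼_ A
      A-directed x y Ax Ay
        with irreducible-meets IsClosedT (proj₂ (proj₂ irreducible))
               (minus-open-closed closed (up-open x)) (minus-open-closed closed (up-open y))
               (inj₁ x , Ax , ≼-refl) (inj₁ y , Ay , ≼-refl)
      ... | r , Fr , x≼r , y≼r with points-below-directed r x y x≼r y≼r
      ...   | z , z≼r , x≼z , y≼z = z , closed-down closed r (inj₁ z) z≼r Fr , x≼z , y≼z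

      point-greatest : HasGreatest _≼_ A → HasGreatest _≼'_ F
      point-greatest (m , Am , greatest) = inj₁ m , Am , below-m
        where
        below-m : ∀ q → F q → q ≼' inj₁ m
        below-m (inj₁ x) Fx = greatest x Fx
        below-m (inj₂ (C , nonSober)) FC = ⊥-elim (nonSober-unbounded nonSober m
          λ c Cc → greatest c (closed-down closed (∞ nonSober) (inj₁ c) Cc FC))

      A-nonSober : ¬ HasGreatest _≼_ A → IsNonSober A
      A-nonSober noGreatest = A-closed , directed⇒irreducible A-closed A-nonempty A-directed
        , λ (x , A≐↓x) → noGreatest (x , proj₂ (A≐↓x x) ≼-refl , λ a → proj₁ (A≐↓x a))

      ∞-greatest : (nonSober : IsNonSober A) → HasGreatest _≼'_ F
      ∞-greatest nonSober = ∞ nonSober , F∞ , below-∞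
        where
        F∞ : F (∞ nonSober)
        F∞ = closed-supremum closed (embed-directed nonSober) (embed-supremum nonSober)
               λ { (inj₁ x) Ax → Ax }
        below-∞ : ∀ q → F q → q ≼' ∞ nonSober
        below-∞ (inj₁ x) Ax = Ax
        below-∞ (inj₂ (C , nonSoberᶜ)) FC = nonSober-nested nonSoberᶜ nonSober
          λ c Cc → closed-down closed (∞ nonSoberᶜ) (inj₁ c) Cc FC

      greatest : HasGreatest _≼'_ F
      greatest with em {P = HasGreatest _≼_ A}
      ... | yes hasGreatest = point-greatest hasGreatest
      ... | no noGreatest = ∞-greatest (A-nonSober noGreatest)

    sober : IsSober
    sober F irreducible with Irreducible.greatest irreducible
    ... | p , Fp , greatest = p , F≐closure , unique
      where
      F≐closure : F ≐ closure p
      F≐closure q = (λ Fq → proj₂ (closure≐down p q) (greatest q Fq))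
                  , (λ q∈cl → closed-down (proj₁ irreducible) p q (proj₁ (closure≐down p q) q∈cl) Fp)
      unique : ∀ q → F ≐ closure q → q ≈∞ p
      unique q F≐closure-q = ≼′-antisym p q p≼q (greatest q Fq)
        where
        p≼q : p ≼' q
        p≼q = proj₁ (closure≐down q p) (proj₁ (F≐closure-q p) Fp)
        Fq : F q
        Fq = proj₂ (F≐closure-q q) (proj₂ (closure≐down q q) (≼′-refl q))

proposition37 : (em : ∀ {ℓ} → ExcludedMiddle ℓ) →
    (X : Set) (_≼_ : Rel X 0ℓ) → IsSimplePrefixOrder _≼_ →
    Sobriety.IsSober (Alexandroff._≈∞_ _≼_) (Alexandroff.IsScottOpen _≼_)
proposition37 em X _≼_ simple = Classical.SimplePrefixOrder.sober em _≼_ simple
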